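{- Let $(x_1,\dots,x_{12})\in\mathbb{N}^{12}$ satisfy, for some $r$, $x_1+x_2+x_9=x_1+x_3+x_{10}=x_2+x_4+x_{12}=x_3+x_4+x_{11}=x_5+x_6+x_9=x_5+x_7+x_{10}=x_6+x_8+x_{12}=x_7+x_8+x_{11}=r$. Suppose $i\in\{2,\dots,12\}$ is such that $x_1<x_i$ and $x_i=\min\{x_2,\dots,x_{12}\}$. Then $i\notin\{2,3,9,10\}$ and $i\neq 8$.
   Context: The equations express that $(x_1,\dots,x_{12})$ is a magic labelling of the cube whose edges are numbered so that the eight vertices are incident to the edge triples $\{1,2,9\},\{1,3,10\},\{2,4,12\},\{3,4,11\},\{5,6,9\},\{5,7,10\},\{6,8,12\},\{7,8,11\}$. $\mathbb{N}=\{0,1,2,\dots\}$. -}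

module Defs where

open import Data.Nat using (ℕ; _+_)
open import Data.Fin using (Fin; #_)
open import Relation.Binary.PropositionalEquality using (_≡_)
open import Data.Product using (_×_)

-- A labelling (x₁,…,x₁₂) ∈ ℕ¹² is a function Fin 12 → ℕ;
-- the paper's x_k is  x (# (k - 1)),  written  x ⟨ k ⟩  below (k = 1..12).
_⟨_⟩ : (Fin 12 → ℕ) → (k : ℕ) → ℕ
x ⟨ 0 ⟩ = x (# 0)
x ⟨ 1 ⟩ = x (# 0)
x ⟨ 2 ⟩ = x (# 1)
x ⟨ 3 ⟩ = x (# 2)
x ⟨ 4 ⟩ = x (# 3)
x ⟨ 5 ⟩ = x (# 4)
x ⟨ 6 ⟩ = x (# 5)
x ⟨ 7 ⟩ = x (# 6)
x ⟨ 8 ⟩ = x (# 7)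
x ⟨ 9 ⟩ = x (# 8)
x ⟨ 10 ⟩ = x (# 9)
x ⟨ 11 ⟩ = x (# 10)
x ⟨ _ ⟩ = x (# 11)

Magic : (Fin 12 → ℕ) → ℕ → Set
Magic x r =
  (x ⟨ 1 ⟩ + x ⟨ 2 ⟩ + x ⟨ 9 ⟩ ≡ r) ×
  (x ⟨ 1 ⟩ + x ⟨ 3 ⟩ + x ⟨ 10 ⟩ ≡ r) ×
  (x ⟨ 2 ⟩ + x ⟨ 4 ⟩ + x ⟨ 12 ⟩ ≡ r) ×
  (x ⟨ 3 ⟩ + x ⟨ 4 ⟩ + x ⟨ 11 ⟩ ≡ r) ×
  (x ⟨ 5 ⟩ + x ⟨ 6 ⟩ + x ⟨ 9 ⟩ ≡ r) ×
  (x ⟨ 5 ⟩ + x ⟨ 7 ⟩ + x ⟨ 10 ⟩ ≡ r) ×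
  (x ⟨ 6 ⟩ + x ⟨ 8 ⟩ + x ⟨ 12 ⟩ ≡ r) ×
  (x ⟨ 7 ⟩ + x ⟨ 8 ⟩ + x ⟨ 11 ⟩ ≡ r)

{-# OPTIONS --safe #-}
module Submission where

-- Each excluded index i yields a balance x₁ + xᵢ = xⱼ + xₖ between labels, read off from
-- two vertices sharing an edge (for i = 8, from two such pairs chained together) with
-- j, k ≠ 1.  If xᵢ were the minimum of x₂,…,x₁₂ and larger than x₁, the left side
-- would be smaller than 2xᵢ while the right side is at least 2xᵢ.

open import Defs
open import Data.Nat using (ℕ; _<_; _≤_; _+_)
open import Data.Nat.Properties using (+-assoc; +-cancelʳ-≡; +-cancelˡ-≡; +-monoˡ-<; +-mono-≤; <-irrefl; module ≤-Reasoning)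
open import Data.Nat.Tactic.RingSolver using (solve-∀)
open import Data.Fin using (Fin; zero; #_)
open import Data.Product using (_×_; _,_)
open import Relation.Binary.PropositionalEquality using (_≡_; _≢_; refl; sym; trans; cong₂)

+-≢-below-min : ∀ {a b c d} → a < b → b ≤ c → b ≤ d → a + b ≢ c + d
+-≢-below-min {a} {b} {c} {d} a<b b≤c b≤d eq = <-irrefl eq (begin-strict
  a + b  <⟨ +-monoˡ-< b a<b ⟩
  b + b  ≤⟨ +-mono-≤ b≤c b≤d ⟩
  c + d  ∎)
  where open ≤-Reasoning

+-cancel-shared-last : ∀ a b c d e → a + b + e ≡ c + d + e → a + b ≡ c + d
+-cancel-shared-last a b c d e = +-cancelʳ-≡ e (a + b) (c + d)

+-cancel-shared-second : ∀ a b c d e → a + b + c ≡ b + d + e → a + c ≡ d + e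
+-cancel-shared-second a b c d e eq = +-cancelˡ-≡ b (a + c) (d + e)
  (trans (move-b a b c) (trans eq (+-assoc b d e)))
  where
  move-b : ∀ a b c → b + (a + c) ≡ a + b + c
  move-b = solve-∀

+-balance-trans : ∀ a b c d e f → a + b ≡ c + d → b + e ≡ d + f → a + f ≡ c + e
+-balance-trans a b c d e f ab≡cd be≡df = +-cancelʳ-≡ (b + d) (a + f) (c + e)
  (trans (regroupˡ a b d f) (trans (cong₂ _+_ ab≡cd (sym be≡df)) (regroupʳ b c d e)))
  where
  regroupˡ : ∀ a b d f → a + f + (b + d) ≡ (a + b) + (d + f)
  regroupˡ = solve-∀
  regroupʳ : ∀ b c d e → (c + d) + (b + e) ≡ c + e + (b + d)
  regroupʳ = solve-∀

Balances : (Fin 12 → ℕ) → Set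
Balances x =
  (x ⟨ 1 ⟩ + x ⟨ 2 ⟩ ≡ x ⟨ 5 ⟩ + x ⟨ 6 ⟩) ×
  (x ⟨ 1 ⟩ + x ⟨ 3 ⟩ ≡ x ⟨ 5 ⟩ + x ⟨ 7 ⟩) ×
  (x ⟨ 1 ⟩ + x ⟨ 9 ⟩ ≡ x ⟨ 4 ⟩ + x ⟨ 12 ⟩) ×
  (x ⟨ 1 ⟩ + x ⟨ 10 ⟩ ≡ x ⟨ 4 ⟩ + x ⟨ 11 ⟩) ×
  (x ⟨ 1 ⟩ + x ⟨ 8 ⟩ ≡ x ⟨ 5 ⟩ + x ⟨ 4 ⟩)

magic⇒balances : ∀ x {r} → Magic x r → Balances x
magic⇒balances x (v₁ , v₂ , v₃ , v₄ , v₅ , v₆ , v₇ , v₈) =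
  b₂ ,
  +-cancel-shared-last (X 1) (X 3) (X 5) (X 7) (X 10) (trans v₂ (sym v₆)) ,
  +-cancel-shared-second (X 1) (X 2) (X 9) (X 4) (X 12) (trans v₁ (sym v₃)) ,
  +-cancel-shared-second (X 1) (X 3) (X 10) (X 4) (X 11) (trans v₂ (sym v₄)) ,
  +-balance-trans (X 1) (X 2) (X 5) (X 6) (X 4) (X 8) b₂ b₁₂
  where
  X : ℕ → ℕ
  X k = x ⟨ k ⟩
  b₂ : X 1 + X 2 ≡ X 5 + X 6
  b₂ = +-cancel-shared-last (X 1) (X 2) (X 5) (X 6) (X 9) (trans v₁ (sym v₅))
  b₁₂ : X 2 + X 4 ≡ X 6 + X 8
  b₁₂ = +-cancel-shared-last (X 2) (X 4) (X 6) (X 8) (X 12) (trans v₃ (sym v₇))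

lemma3p1 : (x : Fin 12 → ℕ) (r : ℕ) → Magic x r →
    (i : Fin 12) → i ≢ zero → x zero < x i →
    ((j : Fin 12) → j ≢ zero → x i ≤ x j) →
    (i ≢ # 1) × (i ≢ # 2) × (i ≢ # 8) × (i ≢ # 9) × (i ≢ # 7)
lemma3p1 x r magic i _ x₁<xᵢ min with magic⇒balances x magic
... | b₂ , b₃ , b₉ , b₁₀ , b₈ =
  (λ { refl → +-≢-below-min x₁<xᵢ (min (# 4) (λ ())) (min (# 5) (λ ())) b₂ }) ,
  (λ { refl → +-≢-below-min x₁<xᵢ (min (# 4) (λ ())) (min (# 6) (λ ())) b₃ }) ,
  (λ { refl → +-≢-below-min x₁<xᵢ (min (# 3) (λ ())) (min (# 11) (λ ())) b₉ }) ,
  (λ { refl → +-≢-below-min x₁<xᵢ (min (# 3) (λ ())) (min (# 10) (λ ())) b₁₀ }) ,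
  (λ { refl → +-≢-below-min x₁<xᵢ (min (# 4) (λ ())) (min (# 3) (λ ())) b₈ })
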